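{- If $\mathbf{\Delta}$ is a c-chain and $g$ is an order-preserving partial function on $\mathbf{\Delta}$, then $g^{[\ell]}$ and $g^{[r]}$ are order-preserving partial functions over $\mathbf{\Delta}$.
   Context: A c-chain is a triple $\mathbf{\Delta}=(\Delta,\leq,\lessdot)$ where $(\Delta,\leq)$ is a finite chain and $\lessdot$ is a subset of the covering relation $\prec$ of $(\Delta,\leq)$ (i.e. $a\lessdot b$ implies $b$ covers $a$). A partial function $g$ on $\Delta$ is order-preserving if $a\leq b$ implies $g(a)\leq g(b)$ for $a,b\in Dom(g)$. The relation $g^{[\ell]}$ on $\Delta$ is defined by: $(x,b)\in g^{[\ell]}$ iff $b\in Dom(g)$ and there exists $a\in Dom(g)$ with $a\lessdot b$ and $g(a)<x\leq g(b)$. The relation $g^{[r]}$ is defined by: $(x,a)\in g^{[r]}$ iff $a\in Dom(g)$ and there exists $b\in Dom(g)$ with $a\lessdot b$ and $g(a)\leq x<g(b)$. -}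

module Defs where

open import Data.Nat using (ℕ)
open import Data.Fin using (Fin; _≤_; _<_)
open import Data.Maybe using (Maybe; just)
open import Data.Product using (Σ; _×_; ∃-syntax)
open import Relation.Binary.PropositionalEquality using (_≡_)
open import Relation.Nullary using (¬_)

-- A finite chain (Δ, ≤) is modelled (up to isomorphism) as Fin n with its usual order.

Covers : {n : ℕ} → Fin n → Fin n → Set
Covers {n} a b = (a < b) × (¬ (Σ (Fin n) λ c → (a < c) × (c < b)))

record CChain (n : ℕ) : Set₁ where
  field
    _⋖_ : Fin n → Fin n → Set
    ⋖⊆covers : ∀ {a b} → a ⋖ b → Covers a b

-- Partial functions on Fin n, represented as Maybe-valued functions.
-- a ∈ Dom(g) iff g a ≡ just (g(a)).
PartialFun : ℕ → Set
PartialFun n = Fin n → Maybe (Fin n)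

OrderPreserving : {n : ℕ} → PartialFun n → Set
OrderPreserving g = ∀ a b ga gb → g a ≡ just ga → g b ≡ just gb → a ≤ b → ga ≤ gb

Rel : ℕ → Set₁
Rel n = Fin n → Fin n → Set

IsPartialFunction : {n : ℕ} → Rel n → Set
IsPartialFunction R = ∀ x y z → R x y → R x z → y ≡ z

RelOrderPreserving : {n : ℕ} → Rel n → Set
RelOrderPreserving R = ∀ a b c d → R a c → R b d → a ≤ b → c ≤ d

gℓ : {n : ℕ} → CChain n → PartialFun n → Rel n
gℓ Δ g x b = let open CChain Δ in
  ∃[ gb ] ((g b ≡ just gb) × (∃[ a ] ∃[ ga ] ((g a ≡ just ga) × (a ⋖ b) × (ga < x) × (x ≤ gb))))

gr : {n : ℕ} → CChain n → PartialFun n → Rel n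
gr Δ g x a = let open CChain Δ in
  ∃[ ga ] ((g a ≡ just ga) × (∃[ b ] ∃[ gb ] ((g b ≡ just gb) × (a ⋖ b) × (ga ≤ x) × (x < gb))))

-- Suppose x ≤ y with (x, c) and (y, d) in g^[ℓ] (resp. g^[r]) but d < c. The
-- cover c₀ ⋖ c witnessing (x, c) forces d ≤ c₀ (resp. the cover d ⋖ d₁ forces
-- d₁ ≤ c), and monotonicity of g then yields g(d) ≤ g(c₀) < x ≤ y ≤ g(d)
-- (resp. g(d₁) ≤ g(c) ≤ x ≤ y < g(d₁)). Functionality is the case x = y.
module Submission where

open import Defs
open import Data.Nat using (ℕ)
open import Data.Nat.Properties using (≮⇒≥; <-irrefl; module ≤-Reasoning)
open import Data.Fin using (Fin; toℕ; _≤_; _<_)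
open import Data.Fin.Properties using (≤-refl; ≤-antisym)
open import Data.Product using (_×_; _,_; proj₂)
open import Function using (_$_)
open import Relation.Binary.PropositionalEquality using (refl)

module _ {n : ℕ} {a b c : Fin n} (a-covered-by-b : Covers a b) where

  covers-≤ˡ : c < b → c ≤ a
  covers-≤ˡ c<b = ≮⇒≥ λ a<c → proj₂ a-covered-by-b (c , a<c , c<b)

  covers-≤ʳ : a < c → b ≤ c
  covers-≤ʳ a<c = ≮⇒≥ λ c<b → proj₂ a-covered-by-b (c , a<c , c<b)

orderPreserving⇒partialFunction : {n : ℕ} {R : Rel n} →
  RelOrderPreserving R → IsPartialFunction R
orderPreserving⇒partialFunction mono x y z Rxy Rxz =
  ≤-antisym (mono x x y z Rxy Rxz ≤-refl) (mono x x z y Rxz Rxy ≤-refl)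

module _ {n : ℕ} (Δ : CChain n) {g : PartialFun n} (mono : OrderPreserving g) where
  open CChain Δ
  open ≤-Reasoning

  gℓ-orderPreserving : RelOrderPreserving (gℓ Δ g)
  gℓ-orderPreserving x y c d
    (_ , _ , c₀ , gc₀ , gc₀≡ , c₀⋖c , gc₀<x , _)
    (gd , gd≡ , _ , _ , _ , _ , _ , y≤gd) x≤y =
    ≮⇒≥ λ d<c → <-irrefl refl $ begin-strict
      toℕ gd  ≤⟨ mono d c₀ gd gc₀ gd≡ gc₀≡ (covers-≤ˡ (⋖⊆covers c₀⋖c) d<c) ⟩
      toℕ gc₀ <⟨ gc₀<x ⟩
      toℕ x   ≤⟨ x≤y ⟩
      toℕ y   ≤⟨ y≤gd ⟩
      toℕ gd  ∎

  gr-orderPreserving : RelOrderPreserving (gr Δ g)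
  gr-orderPreserving x y c d
    (gc , gc≡ , _ , _ , _ , _ , gc≤x , _)
    (_ , _ , d₁ , gd₁ , gd₁≡ , d⋖d₁ , _ , y<gd₁) x≤y =
    ≮⇒≥ λ d<c → <-irrefl refl $ begin-strict
      toℕ gd₁ ≤⟨ mono d₁ c gd₁ gc gd₁≡ gc≡ (covers-≤ʳ (⋖⊆covers d⋖d₁) d<c) ⟩
      toℕ gc  ≤⟨ gc≤x ⟩
      toℕ x   ≤⟨ x≤y ⟩
      toℕ y   <⟨ y<gd₁ ⟩
      toℕ gd₁ ∎

lemma3p3 : (n : ℕ) (Δ : CChain n) (g : PartialFun n) → OrderPreserving g →
    (IsPartialFunction (gℓ Δ g) × RelOrderPreserving (gℓ Δ g)) ×
    (IsPartialFunction (gr Δ g) × RelOrderPreserving (gr Δ g))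
lemma3p3 n Δ g mono =
  (orderPreserving⇒partialFunction gℓ-mono , gℓ-mono) ,
  (orderPreserving⇒partialFunction gr-mono , gr-mono)
  where
  gℓ-mono : RelOrderPreserving (gℓ Δ g)
  gℓ-mono = gℓ-orderPreserving Δ mono

  gr-mono : RelOrderPreserving (gr Δ g)
  gr-mono = gr-orderPreserving Δ mono
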